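{- Let $\mathcal{P}=(\mathcal{E},D,c,f_c)$ be a combinatorial sum problem and $E=\{e_1,e_2\}\subseteq\mathcal{E}$. Then $l'_{\mathcal{P}}(E)=\min\{f_c(D_{+}(e_1))-c^\ast+f_c(D_{+}(e_2))-c^\ast,\ f_c(D_{+}(E))-c^\ast\}=\min\{l'_{\mathcal{P}}(e_1)+l'_{\mathcal{P}}(e_2),\ f_c(D_{+}(E))-c^\ast\}$.
   Context: A combinatorial sum problem (CSP) is a tuple $\mathcal{P}=(\mathcal{E},D,c,f_c)$, where $\mathcal{E}$ is a finite ground set, $D\subseteq 2^{\mathcal{E}}\setminus\{\emptyset\}$ is the set of feasible solutions, $c:\mathcal{E}\to\mathbb{R}$ and $f_c(S)=\sum_{e\in S}c(e)$ for $S\in D$. For $M\subseteq D$, $f_c(M)=\min_{S\in M}f_c(S)$, with $f_c(\emptyset)=\infty$; $c^\ast=f_c(D)$. $D_{+}(A)=\{S\in D: A\subseteq S\}$, and $D_{+}(e)=D_{+}(\{e\})$. For $F=\{f_1,\dots,f_m\}\subseteq\mathcal{E}$ and $\vec\alpha\in\mathbb{R}^m$, $\mathcal{P}_{c_{ -\vec\alpha,F}}$ is the CSP with cost of $f_i$ changed to $c(f_i)-\alpha_i$ and other costs unchanged. Single lower tolerance: $l'_{\mathcal{P}}(e)=\max\{\alpha\ge0:$ the optimal value of $\mathcal{P}_{c_{ -\alpha,e}}$ equals $c^\ast\}$. Set lower tolerance: $l'_{\mathcal{P}}(F)=\max\{\alpha\in\mathbb{R}:$ there exists $\vec\alpha$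 with all $\alpha_i\ge0$, $\alpha=\sum_i\alpha_i$, such that the optimal value of $\mathcal{P}_{c_{ -\vec\alpha,F}}$ equals $c^\ast\}$. Tolerances take the value $\infty$ when the set is unbounded. -}

module Defs where

open import Level using (0ℓ)
open import Data.Nat using (ℕ)
open import Data.Fin using (Fin; zero; suc; _≟_)
open import Data.Fin.Subset using (Subset; _∈_; _⊆_; ⁅_⁆; _∪_)
open import Data.Bool using (Bool; true; false; if_then_else_)
open import Data.Vec using (Vec; []; _∷_)
open import Data.Product using (Σ; _×_; ∃)
open import Data.Sum using (_⊎_)
open import Data.Empty using (⊥)
open import Relation.Nullary using (¬_)
open import Relation.Nullary.Decidable using (⌊_⌋)
open import Relation.Binary.PropositionalEquality using (_≡_; _≢_)
open import Algebra.Structures using (IsCommutativeRing)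

-- The real numbers, given axiomatically as a Dedekind-complete ordered
-- field (every model is isomorphic to ℝ).  The theorem is stated for an
-- arbitrary model.

record RealField : Set₁ where
  infixl 6 _+_ _-_
  infixl 7 _*_
  infix 4 _≤_ _<_
  field
    ℝ : Set
    0r 1r : ℝ
    _+_ _*_ : ℝ → ℝ → ℝ
    -_ : ℝ → ℝ
    _≤_ : ℝ → ℝ → Set
    isCommutativeRing : IsCommutativeRing _≡_ _+_ _*_ -_ 0r 1r
    0≢1 : 0r ≢ 1r
    *-inverse : ∀ x → x ≢ 0r → Σ ℝ (λ y → x * y ≡ 1r)
    ≤-refl : ∀ {x} → x ≤ x
    ≤-trans : ∀ {x y z} → x ≤ y → y ≤ z → x ≤ z
    ≤-antisym : ∀ {x y} → x ≤ y → y ≤ x → x ≡ y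
    ≤-total : ∀ x y → x ≤ y ⊎ y ≤ x
    +-mono-≤ : ∀ {x y} z → x ≤ y → x + z ≤ y + z
    *-nonneg : ∀ {x y} → 0r ≤ x → 0r ≤ y → 0r ≤ x * y
    completeness : (A : ℝ → Set) → Σ ℝ A → Σ ℝ (λ b → ∀ a → A a → a ≤ b) →
                   Σ ℝ (λ s → (∀ a → A a → a ≤ s) ×
                              (∀ b → (∀ a → A a → a ≤ b) → s ≤ b))

  _-_ : ℝ → ℝ → ℝ
  x - y = x + (- y)

  _<_ : ℝ → ℝ → Set
  x < y = x ≤ y × x ≢ y

module CSP (R : RealField) where
  open RealField R

  data ℝ∞ : Set where
    fin : ℝ → ℝ∞
    ∞   : ℝ∞

  _+∞_ : ℝ∞ → ℝ∞ → ℝ∞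
  fin x +∞ fin y = fin (x + y)
  fin x +∞ ∞     = ∞
  ∞     +∞ _     = ∞

  _-∞_ : ℝ∞ → ℝ → ℝ∞
  fin x -∞ y = fin (x - y)
  ∞     -∞ y = ∞

  data IsMin∞ : ℝ∞ → ℝ∞ → ℝ∞ → Set where
    min-∞ˡ : ∀ v → IsMin∞ ∞ v v
    min-∞ʳ : ∀ x → IsMin∞ (fin x) ∞ (fin x)
    min-ˡ  : ∀ {x y} → x ≤ y → IsMin∞ (fin x) (fin y) (fin x)
    min-ʳ  : ∀ {x y} → y ≤ x → IsMin∞ (fin x) (fin y) (fin y)

  IsLeast : (ℝ → Set) → ℝ∞ → Set
  IsLeast A (fin r) = A r × (∀ a → A a → r ≤ a)
  IsLeast A ∞       = ∀ a → ¬ A a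

  IsGreatest : (ℝ → Set) → ℝ∞ → Set
  IsGreatest A (fin r) = A r × (∀ a → A a → a ≤ r)
  IsGreatest A ∞       = ∀ b → Σ ℝ (λ a → A a × b < a)

  -- f_c(S) = Σ_{e ∈ S} c(e), for S ⊆ Fin n given as characteristic vector
  cost : ∀ {n} → (Fin n → ℝ) → Subset n → ℝ
  cost c [] = 0r
  cost c (b ∷ bs) = (if b then c zero else 0r) + cost (λ i → c (suc i)) bs

  module _ {n : ℕ} (D : Subset n → Bool) where

    -- { f_c(S) : S ∈ D₊(A) }, D₊(A) = { S ∈ D : A ⊆ S }
    costsD₊ : (Fin n → ℝ) → Subset n → ℝ → Set
    costsD₊ c A r = Σ (Subset n) (λ S → D S ≡ true × A ⊆ S × cost c S ≡ r)

    costsD : (Fin n → ℝ) → ℝ → Set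
    costsD c r = Σ (Subset n) (λ S → D S ≡ true × cost c S ≡ r)

    lower : (Fin n → ℝ) → Fin n → ℝ → Fin n → ℝ
    lower c e α x = if ⌊ x ≟ e ⌋ then c x - α else c x

    -- admissible α for the single lower tolerance of e (c* the optimum)
    SingleTolSet : (Fin n → ℝ) → ℝ → Fin n → ℝ → Set
    SingleTolSet c c* e α = 0r ≤ α × IsLeast (costsD (lower c e α)) (fin c*)

    -- admissible α for the set lower tolerance of F = {e₁, e₂}
    PairTolSet : (Fin n → ℝ) → ℝ → Fin n → Fin n → ℝ → Set
    PairTolSet c c* e₁ e₂ α =
      Σ ℝ (λ α₁ → Σ ℝ (λ α₂ → 0r ≤ α₁ × 0r ≤ α₂ × α ≡ α₁ + α₂ ×
        IsLeast (costsD (lower (lower c e₁ α₁) e₂ α₂)) (fin c*)))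

{-# OPTIONS --safe #-}
-- Lowering the costs of e₁, e₂ by α₁, α₂ ≥ 0 keeps the optimum c* exactly when every
-- feasible set containing e₁ still costs at least c* + α₁, every one containing e₂ at
-- least c* + α₂, and every one containing both at least c* + α₁ + α₂; that is, when
-- α₁ ≤ f(D₊(e₁)) - c*, α₂ ≤ f(D₊(e₂)) - c* and α₁ + α₂ ≤ f(D₊(E)) - c*.  The largest
-- α₁ + α₂ under these three caps is the smaller of the sum of the first two and the third:
-- when the third is smaller it is reached with α₁ at its cap, which is possible because
-- D₊(E) ⊆ D₊(e₁).  With one element the same computation gives l′(eᵢ) = f(D₊(eᵢ)) - c*.
module Submission where

open import Defs
open import Data.Nat using (ℕ)
open import Data.Fin using (Fin; zero; suc; _≟_)
open import Data.Fin.Properties using (suc-injective)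
open import Data.Fin.Subset using (Subset; Nonempty; ⁅_⁆; _∪_; _∈_; _∉_; _⊆_)
open import Data.Fin.Subset.Properties using (_∈?_; x∈⁅x⁆; x∈⁅y⁆⇒x≡y; p⊆p∪q; q⊆p∪q; x∈p∪q⁻)
open import Data.Vec.Base using (_∷_; []; here; there)
open import Data.Bool using (Bool; true; false; if_then_else_)
open import Data.Product using (Σ; _×_; _,_; proj₁; proj₂; uncurry)
open import Data.Product.Function.NonDependent.Propositional using (_×-⇔_)
open import Data.Product.Function.Dependent.Propositional using (congˡ)
open import Data.Sum using (inj₁; inj₂; [_,_]′)
open import Data.Empty using (⊥-elim)
open import Function.Bundles using (_⇔_; mk⇔; Equivalence)
open import Function.Construct.Composition using (_⇔-∘_)
open import Function.Construct.Symmetry using (⇔-sym)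
open import Relation.Nullary using (¬_; yes; no)
open import Relation.Binary.PropositionalEquality
  using (_≡_; _≢_; refl; sym; trans; cong; cong₂; subst; subst₂; module ≡-Reasoning)
open import Algebra.Bundles using (CommutativeRing)
import Algebra.Properties.AbelianGroup as AbelianGroupProperties
import Algebra.Properties.Ring as RingProperties

module OrderedField (R : RealField) where
  open RealField R

  commutativeRing : CommutativeRing _ _
  commutativeRing = record
    { Carrier = ℝ ; _≈_ = _≡_ ; _+_ = _+_ ; _*_ = _*_ ; -_ = -_ ; 0# = 0r ; 1# = 1r
    ; isCommutativeRing = isCommutativeRing }

  open CommutativeRing commutativeRing public using (+-comm; +-assoc; +-identityˡ; +-identityʳ)
  open CommutativeRing commutativeRing using (-‿inverseʳ; +-abelianGroup; ring)
  open AbelianGroupProperties +-abelianGroup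
    using (//-rightDividesˡ; //-rightDividesʳ; xyx⁻¹≈y; ⁻¹-∙-comm; ⁻¹-involutive)
  open RingProperties ring using (-1*x≈-x)

  x+[y-x]≡y : ∀ x y → x + (y - x) ≡ y
  x+[y-x]≡y x y = trans (+-comm x (y - x)) (//-rightDividesˡ x y)

  [x-y]-z≡x-[y+z] : ∀ x y z → (x - y) - z ≡ x - (y + z)
  [x-y]-z≡x-[y+z] x y z = trans (+-assoc x (- y) (- z)) (cong (x +_) (⁻¹-∙-comm y z))

  [x-z]+y≡[x+y]-z : ∀ x y z → (x - z) + y ≡ (x + y) - z
  [x-z]+y≡[x+y]-z x y z = begin
    (x - z) + y   ≡⟨ +-assoc x (- z) y ⟩
    x + (- z + y) ≡⟨ cong (x +_) (+-comm (- z) y) ⟩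
    x + (y - z)   ≡⟨ +-assoc x y (- z) ⟨
    (x + y) - z   ∎
    where open ≡-Reasoning

  +-monoʳ-≤ : ∀ z {x y} → x ≤ y → z + x ≤ z + y
  +-monoʳ-≤ z {x} {y} x≤y = subst₂ _≤_ (+-comm x z) (+-comm y z) (+-mono-≤ z x≤y)

  +-mono-≤₂ : ∀ {x y u v} → x ≤ y → u ≤ v → x + u ≤ y + v
  +-mono-≤₂ {y = y} x≤y u≤v = ≤-trans (+-mono-≤ _ x≤y) (+-monoʳ-≤ y u≤v)

  x+y≤z⇒x≤z-y : ∀ {x y z} → x + y ≤ z → x ≤ z - y
  x+y≤z⇒x≤z-y {x} {y} h = subst (_≤ _) (//-rightDividesʳ y x) (+-mono-≤ (- y) h)

  x≤z-y⇒x+y≤z : ∀ {x y z} → x ≤ z - y → x + y ≤ z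
  x≤z-y⇒x+y≤z {y = y} {z} h = subst (_ ≤_) (//-rightDividesˡ y z) (+-mono-≤ y h)

  x≤y+z⇒x-z≤y : ∀ {x y z} → x ≤ y + z → x - z ≤ y
  x≤y+z⇒x-z≤y {y = y} {z} h = subst (_ ≤_) (//-rightDividesʳ z y) (+-mono-≤ (- z) h)

  x≤y⇒0≤y-x : ∀ {x y} → x ≤ y → 0r ≤ y - x
  x≤y⇒0≤y-x {x} h = subst (_≤ _) (-‿inverseʳ x) (+-mono-≤ (- x) h)

  0≤y⇒x-y≤x : ∀ x {y} → 0r ≤ y → x - y ≤ x
  0≤y⇒x-y≤x x {y} h =
    subst₂ _≤_ (+-identityʳ (x - y)) (//-rightDividesˡ y x) (+-monoʳ-≤ (x - y) h)

  ≤-reflexive : ∀ {x y} → x ≡ y → x ≤ y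
  ≤-reflexive refl = ≤-refl

  0≤1 : 0r ≤ 1r
  0≤1 with ≤-total 0r 1r
  ... | inj₁ 0≤1 = 0≤1
  ... | inj₂ 1≤0 = subst (0r ≤_) [-1]*[-1]≡1 (*-nonneg 0≤-1 0≤-1)
    where
    0≤-1 : 0r ≤ - 1r
    0≤-1 = subst₂ _≤_ (-‿inverseʳ 1r) (+-identityˡ (- 1r)) (+-mono-≤ (- 1r) 1≤0)
    [-1]*[-1]≡1 : - 1r * - 1r ≡ 1r
    [-1]*[-1]≡1 = trans (-1*x≈-x (- 1r)) (⁻¹-involutive 1r)

  x≢x+1 : ∀ x → x ≢ x + 1r
  x≢x+1 x x≡x+1 = 0≢1 (begin
    0r            ≡⟨ -‿inverseʳ x ⟨
    x - x         ≡⟨ cong (_- x) x≡x+1 ⟩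
    (x + 1r) - x  ≡⟨ xyx⁻¹≈y x 1r ⟩
    1r            ∎)
    where open ≡-Reasoning

  ∃-nonneg-above : ∀ b → Σ ℝ (λ m → 0r ≤ m × b < m)
  ∃-nonneg-above b with ≤-total 0r b
  ... | inj₁ 0≤b = b + 1r , ≤-trans 0≤b b≤b+1 , b≤b+1 , x≢x+1 b
    where
    b≤b+1 : b ≤ b + 1r
    b≤b+1 = subst (_≤ b + 1r) (+-identityʳ b) (+-monoʳ-≤ b 0≤1)
  ... | inj₂ b≤0 = 1r , 0≤1 , ≤-trans b≤0 0≤1 , b≢1
    where
    b≢1 : b ≢ 1r
    b≢1 refl = 0≢1 (≤-antisym 0≤1 b≤0)

module ExtendedReals (R : RealField) where
  open RealField R
  open CSP R using (ℝ∞; fin; ∞; _+∞_; _-∞_; IsMin∞; min-∞ˡ; min-∞ʳ; min-ˡ; min-ʳ; IsLeast; IsGreatest)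
  open OrderedField R

  infix 4 _≤∞_

  data _≤∞_ : ℝ∞ → ℝ∞ → Set where
    fin≤fin : ∀ {x y} → x ≤ y → fin x ≤∞ fin y
    ≤∞-top  : ∀ {u} → u ≤∞ ∞

  fin≤fin⁻¹ : ∀ {x y} → fin x ≤∞ fin y → x ≤ y
  fin≤fin⁻¹ (fin≤fin x≤y) = x≤y

  ≤∞-shift : ∀ {c α v} → fin (c + α) ≤∞ v ⇔ fin α ≤∞ (v -∞ c)
  ≤∞-shift {c} {α} {fin p} = mk⇔
    (λ { (fin≤fin h) → fin≤fin (x+y≤z⇒x≤z-y (subst (_≤ p) (+-comm c α) h)) })
    (λ { (fin≤fin h) → fin≤fin (subst (_≤ p) (+-comm α c) (x≤z-y⇒x+y≤z h)) })
  ≤∞-shift {v = ∞} = mk⇔ (λ _ → ≤∞-top) (λ _ → ≤∞-top)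

  -∞-mono : ∀ {u v} c → u ≤∞ v → (u -∞ c) ≤∞ (v -∞ c)
  -∞-mono c (fin≤fin h) = fin≤fin (+-mono-≤ (- c) h)
  -∞-mono c ≤∞-top      = ≤∞-top

  +∞-mono : ∀ {x y u v} → fin x ≤∞ u → fin y ≤∞ v → fin (x + y) ≤∞ (u +∞ v)
  +∞-mono (fin≤fin h) (fin≤fin k) = fin≤fin (+-mono-≤₂ h k)
  +∞-mono (fin≤fin _) ≤∞-top      = ≤∞-top
  +∞-mono ≤∞-top      _           = ≤∞-top

  IsMin∞-glb : ∀ {u v w x} → IsMin∞ u v w → x ≤∞ u → x ≤∞ v → x ≤∞ w
  IsMin∞-glb (min-∞ˡ _) _   x≤v = x≤v
  IsMin∞-glb (min-∞ʳ _) x≤u _   = x≤u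
  IsMin∞-glb (min-ˡ _)  x≤u _   = x≤u
  IsMin∞-glb (min-ʳ _)  _   x≤v = x≤v

  IsMin∞-unique : ∀ {u v w w′} → IsMin∞ u v w → IsMin∞ u v w′ → w ≡ w′
  IsMin∞-unique (min-∞ˡ _) (min-∞ˡ _) = refl
  IsMin∞-unique (min-∞ʳ _) (min-∞ʳ _) = refl
  IsMin∞-unique (min-ˡ _)  (min-ˡ _)  = refl
  IsMin∞-unique (min-ˡ h)  (min-ʳ k)  = cong fin (≤-antisym h k)
  IsMin∞-unique (min-ʳ h)  (min-ˡ k)  = cong fin (≤-antisym h k)
  IsMin∞-unique (min-ʳ _)  (min-ʳ _)  = refl

  LowerBound : (ℝ → Set) → ℝ → Set
  LowerBound A x = ∀ a → A a → x ≤ a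

  IsLeast⇒LowerBound⇔ : ∀ {A v x} → IsLeast A v → LowerBound A x ⇔ fin x ≤∞ v
  IsLeast⇒LowerBound⇔ {v = fin r} (Ar , least) = mk⇔
    (λ lb → fin≤fin (lb r Ar))
    (λ { (fin≤fin x≤r) a Aa → ≤-trans x≤r (least a Aa) })
  IsLeast⇒LowerBound⇔ {v = ∞} empty = mk⇔ (λ _ → ≤∞-top) (λ _ a Aa → ⊥-elim (empty a Aa))

  IsLeast-antitone : ∀ {A B : ℝ → Set} {u v} → (∀ a → A a → B a) →
                     IsLeast B u → IsLeast A v → u ≤∞ v
  IsLeast-antitone {v = ∞}             _   _           _        = ≤∞-top
  IsLeast-antitone {u = fin _} {fin r} A⊆B (_ , least) (Ar , _) = fin≤fin (least r (A⊆B r Ar))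
  IsLeast-antitone {u = ∞}     {fin r} A⊆B empty       (Ar , _) = ⊥-elim (empty r (A⊆B r Ar))

  Attains : (ℝ → Set) → ℝ∞ → Set
  Attains A (fin r) = A r
  Attains A ∞       = ∀ b → Σ ℝ (λ a → A a × b < a)

  IsGreatest-intro : ∀ {A v} → (∀ a → A a → fin a ≤∞ v) → Attains A v → IsGreatest A v
  IsGreatest-intro {v = fin r} bounded Ar = Ar , λ a Aa → fin≤fin⁻¹ (bounded a Aa)
  IsGreatest-intro {v = ∞}     _       unbounded = unbounded

  IsGreatest-cong : ∀ {A B v} → (∀ a → A a ⇔ B a) → IsGreatest A v → IsGreatest B v
  IsGreatest-cong {v = fin r} A⇔B (Ar , greatest) =
    Equivalence.to (A⇔B r) Ar , λ a Ba → greatest a (Equivalence.from (A⇔B a) Ba)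
  IsGreatest-cong {v = ∞} A⇔B unbounded b with unbounded b
  ... | a , Aa , b<a = a , Equivalence.to (A⇔B a) Aa , b<a

  bounded⇒¬unbounded : ∀ {A x} → (∀ a → A a → a ≤ x) → ¬ Attains A ∞
  bounded⇒¬unbounded bounded unbounded with unbounded _
  ... | a , Aa , x≤a , x≢a = x≢a (≤-antisym x≤a (bounded a Aa))

  IsGreatest-unique : ∀ {A u v} → IsGreatest A u → IsGreatest A v → u ≡ v
  IsGreatest-unique {u = fin x} {fin y} (Ax , x-greatest) (Ay , y-greatest) =
    cong fin (≤-antisym (y-greatest x Ax) (x-greatest y Ay))
  IsGreatest-unique {u = fin _} {∞} (_ , greatest) unbounded =
    ⊥-elim (bounded⇒¬unbounded greatest unbounded)
  IsGreatest-unique {u = ∞} {fin _} unbounded (_ , greatest) =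
    ⊥-elim (bounded⇒¬unbounded greatest unbounded)
  IsGreatest-unique {u = ∞} {∞} _ _ = refl

module CappedSplits (R : RealField) where
  open RealField R
  open CSP R using (ℝ∞; fin; ∞; _+∞_; IsMin∞; min-∞ˡ; min-∞ʳ; min-ˡ; min-ʳ; IsGreatest)
  open OrderedField R
  open ExtendedReals R

  -- PairTolSet D c c* e₁ e₂ is, by definition, Split of the admissible pairs (α₁, α₂).
  Split : (ℝ → ℝ → Set) → ℝ → Set
  Split P α = Σ ℝ (λ α₁ → Σ ℝ (λ α₂ → 0r ≤ α₁ × 0r ≤ α₂ × α ≡ α₁ + α₂ × P α₁ α₂))

  Split-cong : ∀ {P Q : ℝ → ℝ → Set} →
               (∀ {α₁ α₂} → 0r ≤ α₁ → 0r ≤ α₂ → P α₁ α₂ ⇔ Q α₁ α₂) →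
               ∀ α → Split P α ⇔ Split Q α
  Split-cong P⇔Q _ = congˡ (congˡ (congˡ λ {0≤α₁} → congˡ λ {0≤α₂} → congˡ (P⇔Q 0≤α₁ 0≤α₂)))

  Capped : ℝ∞ → ℝ∞ → ℝ∞ → ℝ → ℝ → Set
  Capped A₁ A₂ B α₁ α₂ = fin α₁ ≤∞ A₁ × fin α₂ ≤∞ A₂ × fin (α₁ + α₂) ≤∞ B

  capped-split-bounded : ∀ {A₁ A₂ B X} → IsMin∞ (A₁ +∞ A₂) B X →
                         ∀ α → Split (Capped A₁ A₂ B) α → fin α ≤∞ X
  capped-split-bounded min _ (_ , _ , _ , _ , refl , α₁≤A₁ , α₂≤A₂ , α≤B) =
    IsMin∞-glb min (+∞-mono α₁≤A₁ α₂≤A₂) α≤B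

  split-at-caps : ∀ {a₁ a₂ B} → 0r ≤ a₁ → 0r ≤ a₂ → fin (a₁ + a₂) ≤∞ B →
                  Split (Capped (fin a₁) (fin a₂) B) (a₁ + a₂)
  split-at-caps {a₁} {a₂} 0≤a₁ 0≤a₂ a≤B =
    a₁ , a₂ , 0≤a₁ , 0≤a₂ , refl , fin≤fin ≤-refl , fin≤fin ≤-refl , a≤B

  split-at-cap₁ : ∀ {a₁ A₂ r} → 0r ≤ a₁ → a₁ ≤ r → fin (r - a₁) ≤∞ A₂ →
                  Split (Capped (fin a₁) A₂ (fin r)) r
  split-at-cap₁ {a₁} {r = r} 0≤a₁ a₁≤r rest≤A₂ =
    a₁ , r - a₁ , 0≤a₁ , x≤y⇒0≤y-x a₁≤r , sym (x+[y-x]≡y a₁ r) ,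
    fin≤fin ≤-refl , rest≤A₂ , fin≤fin (≤-reflexive (x+[y-x]≡y a₁ r))

  split-unbounded₁ : ∀ {A₂} → fin 0r ≤∞ A₂ → Attains (Split (Capped ∞ A₂ ∞)) ∞
  split-unbounded₁ 0≤A₂ b with ∃-nonneg-above b
  ... | m , 0≤m , b<m = m , (m , 0r , 0≤m , ≤-refl , sym (+-identityʳ m) , ≤∞-top , 0≤A₂ , ≤∞-top) , b<m

  split-unbounded₂ : ∀ {A₁} → fin 0r ≤∞ A₁ → Attains (Split (Capped A₁ ∞ ∞)) ∞
  split-unbounded₂ 0≤A₁ b with ∃-nonneg-above b
  ... | m , 0≤m , b<m = m , (0r , m , ≤-refl , 0≤m , sym (+-identityˡ m) , 0≤A₁ , ≤∞-top , ≤∞-top) , b<m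

  capped-split-attains : ∀ {A₁ A₂ B X} → fin 0r ≤∞ A₁ → fin 0r ≤∞ A₂ → A₁ ≤∞ B →
                         IsMin∞ (A₁ +∞ A₂) B X → Attains (Split (Capped A₁ A₂ B)) X
  capped-split-attains {∞} _ 0≤A₂ ≤∞-top (min-∞ˡ _) = split-unbounded₁ 0≤A₂
  capped-split-attains {fin _} {∞} {∞} 0≤A₁ _ _ (min-∞ˡ _) = split-unbounded₂ 0≤A₁
  capped-split-attains {fin _} {∞} {fin _} (fin≤fin 0≤a₁) _ (fin≤fin a₁≤r) (min-∞ˡ _) =
    split-at-cap₁ 0≤a₁ a₁≤r ≤∞-top
  capped-split-attains {fin _} {fin _} (fin≤fin 0≤a₁) (fin≤fin 0≤a₂) _ (min-∞ʳ _) =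
    split-at-caps 0≤a₁ 0≤a₂ ≤∞-top
  capped-split-attains {fin _} {fin _} (fin≤fin 0≤a₁) (fin≤fin 0≤a₂) _ (min-ˡ a≤r) =
    split-at-caps 0≤a₁ 0≤a₂ (fin≤fin a≤r)
  capped-split-attains {fin a₁} {fin a₂} {fin r} (fin≤fin 0≤a₁) _ (fin≤fin a₁≤r) (min-ʳ r≤a) =
    split-at-cap₁ 0≤a₁ a₁≤r (fin≤fin (x≤y+z⇒x-z≤y (subst (r ≤_) (+-comm a₁ a₂) r≤a)))

  capped-split-greatest : ∀ {A₁ A₂ B X} → fin 0r ≤∞ A₁ → fin 0r ≤∞ A₂ → A₁ ≤∞ B →
                          IsMin∞ (A₁ +∞ A₂) B X → IsGreatest (Split (Capped A₁ A₂ B)) X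
  capped-split-greatest 0≤A₁ 0≤A₂ A₁≤B min =
    IsGreatest-intro (capped-split-bounded min) (capped-split-attains 0≤A₁ 0≤A₂ A₁≤B min)

  interval-greatest : ∀ {A} → fin 0r ≤∞ A → IsGreatest (λ α → 0r ≤ α × fin α ≤∞ A) A
  interval-greatest {A} 0≤A = IsGreatest-intro (λ _ → proj₂) (attains A 0≤A)
    where
    attains : ∀ A → fin 0r ≤∞ A → Attains (λ α → 0r ≤ α × fin α ≤∞ A) A
    attains (fin a) (fin≤fin 0≤a) = 0≤a , fin≤fin ≤-refl
    attains ∞ _ b with ∃-nonneg-above b
    ... | m , 0≤m , b<m = m , (0≤m , ≤∞-top) , b<m

⁅x⁆⊆p⇔x∈p : ∀ {n} {x : Fin n} {p} → ⁅ x ⁆ ⊆ p ⇔ x ∈ p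
⁅x⁆⊆p⇔x∈p {x = x} {p} = mk⇔
  (λ ⁅x⁆⊆p → ⁅x⁆⊆p (x∈⁅x⁆ x))
  (λ x∈p {y} y∈⁅x⁆ → subst (_∈ p) (sym (x∈⁅y⁆⇒x≡y x y∈⁅x⁆)) x∈p)

⁅x⁆∪⁅y⁆⊆p⇔ : ∀ {n} {x y : Fin n} {p} → ⁅ x ⁆ ∪ ⁅ y ⁆ ⊆ p ⇔ (x ∈ p × y ∈ p)
⁅x⁆∪⁅y⁆⊆p⇔ {x = x} {y} {p} = mk⇔
  (λ ⊆p → ⊆p (p⊆p∪q ⁅ y ⁆ (x∈⁅x⁆ x)) , ⊆p (q⊆p∪q ⁅ x ⁆ ⁅ y ⁆ (x∈⁅x⁆ y)))
  (λ { (x∈p , y∈p) {z} z∈ → [ from x∈p , from y∈p ]′ (x∈p∪q⁻ ⁅ x ⁆ ⁅ y ⁆ z∈) })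
  where
  from : ∀ {w} → w ∈ p → ⁅ w ⁆ ⊆ p
  from = Equivalence.from ⁅x⁆⊆p⇔x∈p

module Costs (R : RealField) where
  open RealField R
  open CSP R using (cost)
  open OrderedField R

  cost-cong-on : ∀ {n} {c c′ : Fin n → ℝ} S → (∀ {x} → x ∈ S → c′ x ≡ c x) → cost c′ S ≡ cost c S
  cost-cong-on []          _     = refl
  cost-cong-on (true ∷ S)  agree = cong₂ _+_ (agree here) (cost-cong-on S (λ x∈S → agree (there x∈S)))
  cost-cong-on (false ∷ S) agree = cong (0r +_) (cost-cong-on S (λ x∈S → agree (there x∈S)))

  cost-update-∉ : ∀ {n} {c c′ : Fin n → ℝ} {e S} → (∀ {x} → x ≢ e → c′ x ≡ c x) →
                  e ∉ S → cost c′ S ≡ cost c S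
  cost-update-∉ agree e∉S = cost-cong-on _ (λ x∈S → agree (λ x≡e → e∉S (subst (_∈ _) x≡e x∈S)))

  cost-update-∈ : ∀ {n} {c c′ : Fin n → ℝ} {e S α} → (∀ {x} → x ≢ e → c′ x ≡ c x) →
                  c′ e ≡ c e - α → e ∈ S → cost c′ S ≡ cost c S - α
  cost-update-∈ {e = zero} {true ∷ S} agree updated here = trans
    (cong₂ _+_ updated (cost-cong-on S (λ _ → agree (λ ()))))
    ([x-z]+y≡[x+y]-z _ _ _)
  cost-update-∈ {e = suc e} {b ∷ S} agree updated (there e∈S) = trans
    (cong₂ _+_ (cong (λ v → if b then v else 0r) (agree (λ ())))
               (cost-update-∈ (λ x≢e → agree (λ sx≡se → x≢e (suc-injective sx≡se))) updated e∈S))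
    (sym (+-assoc _ _ _))

module LowerTolerances (R : RealField) where
  open RealField R
  open CSP R
  open OrderedField R
  open ExtendedReals R
  open CappedSplits R
  open Costs R
  open Equivalence using (to; from)

  module _ {n : ℕ} (D : Subset n → Bool) where

    lower-≢ : ∀ {c e α x} → x ≢ e → lower D c e α x ≡ c x
    lower-≢ {e = e} {x = x} x≢e with x ≟ e
    ... | yes x≡e = ⊥-elim (x≢e x≡e)
    ... | no _    = refl

    lower-≡ : ∀ {c e α} → lower D c e α e ≡ c e - α
    lower-≡ {e = e} with e ≟ e
    ... | yes _   = refl
    ... | no e≢e  = ⊥-elim (e≢e refl)

    cost-lower-∈ : ∀ {c e α S} → e ∈ S → cost (lower D c e α) S ≡ cost c S - α
    cost-lower-∈ {c} {e} {α} = cost-update-∈ (lower-≢ {c} {e} {α}) (lower-≡ {c} {e} {α})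

    cost-lower-∉ : ∀ {c e α S} → e ∉ S → cost (lower D c e α) S ≡ cost c S
    cost-lower-∉ {c} {e} {α} = cost-update-∉ (lower-≢ {c} {e} {α})

    cost-lower-≤ : ∀ {c e α} → 0r ≤ α → ∀ S → cost (lower D c e α) S ≤ cost c S
    cost-lower-≤ {c} {e} 0≤α S with e ∈? S
    ... | yes e∈S = subst (_≤ cost c S) (sym (cost-lower-∈ e∈S)) (0≤y⇒x-y≤x (cost c S) 0≤α)
    ... | no  e∉S = subst (_≤ cost c S) (sym (cost-lower-∉ e∉S)) ≤-refl

    module _ {c : Fin n → ℝ} {c* : ℝ} (optimal : IsLeast (costsD D c) (fin c*)) where

      c*≤cost : ∀ {S} → D S ≡ true → c* ≤ cost c S
      c*≤cost {S} DS = proj₂ optimal _ (S , DS , refl)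

      cost∈costsD₊ : ∀ {A S} → D S ≡ true → A ⊆ S → costsD₊ D c A (cost c S)
      cost∈costsD₊ {S = S} DS A⊆S = S , DS , A⊆S , refl

      optimum-preserved⇔ : ∀ {c′} → (∀ S → cost c′ S ≤ cost c S) →
                           IsLeast (costsD D c′) (fin c*) ⇔ (∀ S → D S ≡ true → c* ≤ cost c′ S)
      optimum-preserved⇔ {c′} c′≤c = mk⇔
        (λ { (_ , least) S DS → least _ (S , DS , refl) })
        (λ stays → attained stays , λ { _ (S , DS , refl) → stays S DS })
        where
        attained : (∀ S → D S ≡ true → c* ≤ cost c′ S) → costsD D c′ c*
        attained stays with proj₁ optimal
        ... | S* , DS* , refl = S* , DS* , ≤-antisym (c′≤c S*) (stays S* DS*)

      c*≤-lowered : ∀ S {α x} → c* + α ≤ cost c S → x ≡ cost c S - α → c* ≤ x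
      c*≤-lowered _ bound refl = x+y≤z⇒x≤z-y bound

      c*+α≤-raised : ∀ S {α x} → c* ≤ x → x ≤ cost c S - α → c* + α ≤ cost c S
      c*+α≤-raised _ c*≤x x≤ = x≤z-y⇒x+y≤z (≤-trans c*≤x x≤)

      single-admissible⇔ : ∀ {e α} → 0r ≤ α →
        IsLeast (costsD D (lower D c e α)) (fin c*) ⇔ LowerBound (costsD₊ D c ⁅ e ⁆) (c* + α)
      single-admissible⇔ {e} {α} 0≤α =
        mk⇔ necessary sufficient ⇔-∘ optimum-preserved⇔ (cost-lower-≤ 0≤α)
        where
        necessary : (∀ S → D S ≡ true → c* ≤ cost (lower D c e α) S) →
                    LowerBound (costsD₊ D c ⁅ e ⁆) (c* + α)
        necessary stays _ (S , DS , ⁅e⁆⊆S , refl) =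
          c*+α≤-raised S (stays S DS) (≤-reflexive (cost-lower-∈ (to ⁅x⁆⊆p⇔x∈p ⁅e⁆⊆S)))
        sufficient : LowerBound (costsD₊ D c ⁅ e ⁆) (c* + α) →
                     ∀ S → D S ≡ true → c* ≤ cost (lower D c e α) S
        sufficient bound S DS with e ∈? S
        ... | yes e∈S =
          c*≤-lowered S (bound _ (cost∈costsD₊ DS (from ⁅x⁆⊆p⇔x∈p e∈S))) (cost-lower-∈ e∈S)
        ... | no  e∉S = subst (c* ≤_) (sym (cost-lower-∉ e∉S)) (c*≤cost DS)

      pair-admissible⇔ : ∀ {e₁ e₂ α₁ α₂} → 0r ≤ α₁ → 0r ≤ α₂ →
        IsLeast (costsD D (lower D (lower D c e₁ α₁) e₂ α₂)) (fin c*) ⇔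
        (LowerBound (costsD₊ D c ⁅ e₁ ⁆) (c* + α₁) ×
         LowerBound (costsD₊ D c ⁅ e₂ ⁆) (c* + α₂) ×
         LowerBound (costsD₊ D c (⁅ e₁ ⁆ ∪ ⁅ e₂ ⁆)) (c* + (α₁ + α₂)))
      pair-admissible⇔ {e₁} {e₂} {α₁} {α₂} 0≤α₁ 0≤α₂ =
        mk⇔ necessary sufficient ⇔-∘
        optimum-preserved⇔ λ S → ≤-trans (cost-lower-≤ 0≤α₂ S) (cost-lower-≤ 0≤α₁ S)
        where
        c₁ c₂ : Fin n → ℝ
        c₁ = lower D c e₁ α₁
        c₂ = lower D c₁ e₂ α₂

        cost-∈∈ : ∀ {S} → e₁ ∈ S → e₂ ∈ S → cost c₂ S ≡ cost c S - (α₁ + α₂)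
        cost-∈∈ e₁∈S e₂∈S =
          trans (cost-lower-∈ e₂∈S)
                (trans (cong (_- α₂) (cost-lower-∈ e₁∈S)) ([x-y]-z≡x-[y+z] _ α₁ α₂))

        necessary : (∀ S → D S ≡ true → c* ≤ cost c₂ S) →
                    LowerBound (costsD₊ D c ⁅ e₁ ⁆) (c* + α₁) ×
                    LowerBound (costsD₊ D c ⁅ e₂ ⁆) (c* + α₂) ×
                    LowerBound (costsD₊ D c (⁅ e₁ ⁆ ∪ ⁅ e₂ ⁆)) (c* + (α₁ + α₂))
        necessary stays =
          (λ { _ (S , DS , ⁅e₁⁆⊆S , refl) → c*+α≤-raised S (stays S DS)
                 (subst (cost c₂ S ≤_) (cost-lower-∈ (to ⁅x⁆⊆p⇔x∈p ⁅e₁⁆⊆S)) (cost-lower-≤ 0≤α₂ S)) }) ,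
          (λ { _ (S , DS , ⁅e₂⁆⊆S , refl) → c*+α≤-raised S (stays S DS)
                 (subst (_≤ cost c S - α₂) (sym (cost-lower-∈ (to ⁅x⁆⊆p⇔x∈p ⁅e₂⁆⊆S)))
                   (+-mono-≤ (- α₂) (cost-lower-≤ 0≤α₁ S))) }) ,
          (λ { _ (S , DS , E⊆S , refl) → c*+α≤-raised S (stays S DS)
                 (≤-reflexive (uncurry cost-∈∈ (to ⁅x⁆∪⁅y⁆⊆p⇔ E⊆S))) })

        sufficient : LowerBound (costsD₊ D c ⁅ e₁ ⁆) (c* + α₁) ×
                     LowerBound (costsD₊ D c ⁅ e₂ ⁆) (c* + α₂) ×
                     LowerBound (costsD₊ D c (⁅ e₁ ⁆ ∪ ⁅ e₂ ⁆)) (c* + (α₁ + α₂)) →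
                     ∀ S → D S ≡ true → c* ≤ cost c₂ S
        sufficient (bound₁ , bound₂ , bound₁₂) S DS with e₁ ∈? S | e₂ ∈? S
        ... | yes e₁∈S | yes e₂∈S =
          c*≤-lowered S (bound₁₂ _ (cost∈costsD₊ DS (from ⁅x⁆∪⁅y⁆⊆p⇔ (e₁∈S , e₂∈S))))
            (cost-∈∈ e₁∈S e₂∈S)
        ... | yes e₁∈S | no e₂∉S =
          c*≤-lowered S (bound₁ _ (cost∈costsD₊ DS (from ⁅x⁆⊆p⇔x∈p e₁∈S)))
            (trans (cost-lower-∉ e₂∉S) (cost-lower-∈ e₁∈S))
        ... | no e₁∉S | yes e₂∈S =
          c*≤-lowered S (bound₂ _ (cost∈costsD₊ DS (from ⁅x⁆⊆p⇔x∈p e₂∈S)))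
            (trans (cost-lower-∈ e₂∈S) (cong (_- α₂) (cost-lower-∉ e₁∉S)))
        ... | no e₁∉S | no e₂∉S =
          subst (c* ≤_) (sym (trans (cost-lower-∉ e₂∉S) (cost-lower-∉ e₁∉S))) (c*≤cost DS)

      excess-bound⇔ : ∀ {A a α} → IsLeast (costsD₊ D c A) a →
                      fin α ≤∞ (a -∞ c*) ⇔ LowerBound (costsD₊ D c A) (c* + α)
      excess-bound⇔ least = ⇔-sym (IsLeast⇒LowerBound⇔ least) ⇔-∘ ⇔-sym ≤∞-shift

      excess-nonneg : ∀ {A a} → IsLeast (costsD₊ D c A) a → fin 0r ≤∞ (a -∞ c*)
      excess-nonneg least = from (excess-bound⇔ least)
        λ { _ (S , DS , _ , refl) → subst (_≤ cost c S) (sym (+-identityʳ c*)) (c*≤cost DS) }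

      single-tolerance : ∀ {e a} → IsLeast (costsD₊ D c ⁅ e ⁆) a →
                         IsGreatest (SingleTolSet D c c* e) (a -∞ c*)
      single-tolerance least = IsGreatest-cong
        (λ _ → congˡ λ {0≤α} → ⇔-sym (single-admissible⇔ 0≤α) ⇔-∘ excess-bound⇔ least)
        (interval-greatest (excess-nonneg least))

      pair-tolerance : ∀ {e₁ e₂ a₁ a₂ d X} →
        IsLeast (costsD₊ D c ⁅ e₁ ⁆) a₁ → IsLeast (costsD₊ D c ⁅ e₂ ⁆) a₂ →
        IsLeast (costsD₊ D c (⁅ e₁ ⁆ ∪ ⁅ e₂ ⁆)) d →
        IsMin∞ ((a₁ -∞ c*) +∞ (a₂ -∞ c*)) (d -∞ c*) X →
        IsGreatest (PairTolSet D c c* e₁ e₂) X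
      pair-tolerance {e₁} {e₂} least₁ least₂ least₁₂ min = IsGreatest-cong
        (Split-cong λ 0≤α₁ 0≤α₂ →
          ⇔-sym (pair-admissible⇔ 0≤α₁ 0≤α₂) ⇔-∘
          (excess-bound⇔ least₁ ×-⇔ excess-bound⇔ least₂ ×-⇔ excess-bound⇔ least₁₂))
        (capped-split-greatest (excess-nonneg least₁) (excess-nonneg least₂)
          (-∞-mono c* (IsLeast-antitone contains-e₁ least₁ least₁₂)) min)
        where
        contains-e₁ : ∀ r → costsD₊ D c (⁅ e₁ ⁆ ∪ ⁅ e₂ ⁆) r → costsD₊ D c ⁅ e₁ ⁆ r
        contains-e₁ _ (S , DS , E⊆S , eq) = S , DS , (λ x∈ → E⊆S (p⊆p∪q ⁅ e₂ ⁆ x∈)) , eq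

open RealField using (ℝ)
open CSP using (ℝ∞; fin; _+∞_; _-∞_; IsMin∞; IsLeast; IsGreatest; costsD; costsD₊; SingleTolSet; PairTolSet)

theorem15 : (R : RealField) {n : ℕ} (D : Subset n → Bool) (c : Fin n → ℝ R) (c* : ℝ R)
    (e₁ e₂ : Fin n) (a₁ a₂ d l₁ l₂ X Y : ℝ∞ R) →
    (∀ S → D S ≡ true → Nonempty S) →
    e₁ ≢ e₂ →
    IsLeast R (costsD R D c) (fin c*) →
    IsLeast R (costsD₊ R D c ⁅ e₁ ⁆) a₁ →
    IsLeast R (costsD₊ R D c ⁅ e₂ ⁆) a₂ →
    IsLeast R (costsD₊ R D c (⁅ e₁ ⁆ ∪ ⁅ e₂ ⁆)) d →
    IsGreatest R (SingleTolSet R D c c* e₁) l₁ →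
    IsGreatest R (SingleTolSet R D c c* e₂) l₂ →
    IsMin∞ R (_+∞_ R (_-∞_ R a₁ c*) (_-∞_ R a₂ c*)) (_-∞_ R d c*) X →
    IsMin∞ R (_+∞_ R l₁ l₂) (_-∞_ R d c*) Y →
    IsGreatest R (PairTolSet R D c c* e₁ e₂) X × X ≡ Y
theorem15 R D c c* e₁ e₂ a₁ a₂ d l₁ l₂ X Y _ _ optimal least₁ least₂ least₁₂ tol₁ tol₂ minX minY =
  pair-tolerance D optimal least₁ least₂ least₁₂ minX , IsMin∞-unique minX minY′
  where
  open ExtendedReals R using (IsGreatest-unique; IsMin∞-unique)
  open LowerTolerances R using (single-tolerance; pair-tolerance)

  l₁≡ : l₁ ≡ _-∞_ R a₁ c*
  l₁≡ = IsGreatest-unique tol₁ (single-tolerance D optimal least₁)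

  l₂≡ : l₂ ≡ _-∞_ R a₂ c*
  l₂≡ = IsGreatest-unique tol₂ (single-tolerance D optimal least₂)

  minY′ : IsMin∞ R (_+∞_ R (_-∞_ R a₁ c*) (_-∞_ R a₂ c*)) (_-∞_ R d c*) Y
  minY′ = subst₂ (λ u v → IsMin∞ R (_+∞_ R u v) (_-∞_ R d c*) Y) l₁≡ l₂≡ minY
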